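{- Let $\mathcal{A}\in\mathbb{R}^{l\times m\times n}$ be a real tensor. There is a tensor $\mathcal{B}\in\mathbb{R}^{2l\times2m\times2n}$ such that the tensor quadratic feasibility system for $\mathcal{B}$ has a real solution if and only if the tensor quadratic feasibility system for $\mathcal{A}$ has a complex solution.
   Context: For a tensor $\mathcal{A}=[\![a_{ijk}]\!]\in\mathbb{F}^{l\times m\times n}$ define its slices $A_i(j,k)=a_{ijk}$ ($m\times n$, $i=1,\dots,l$), $B_j(i,k)=a_{ijk}$ ($l\times n$, $j=1,\dots,m$), $C_k(i,j)=a_{ijk}$ ($l\times m$, $k=1,\dots,n$). The tensor quadratic feasibility system for $\mathcal{A}$ over a field $\mathbb{K}\in\{\mathbb{R},\mathbb{C}\}$ is $$\mathbf{v}^{\top}A_i\mathbf{w}=0\ (i=1,\dots,l),\quad \mathbf{u}^{\top}B_j\mathbf{w}=0\ (j=1,\dots,m),\quad \mathbf{u}^{\top}C_k\mathbf{v}=0\ (k=1,\dots,n),$$ and a solution over $\mathbb{K}$ means $\mathbf{u}\in\mathbb{K}^l,\mathbf{v}\in\mathbb{K}^m,\mathbf{w}\in\mathbb{K}^n$, all three nonzero, satisfying it. -}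

module Defs where

open import Level using (Level; _⊔_)
open import Data.Nat using (ℕ; zero; suc)
open import Data.Fin using (Fin; zero; suc)
open import Data.Product using (_×_; _,_; Σ)
open import Relation.Nullary using (¬_)
open import Algebra.Bundles.Raw using (RawRing)

private variable c ℓ : Level

module _ (K : RawRing c ℓ) where
  open RawRing K

  ∑ : (n : ℕ) → (Fin n → Carrier) → Carrier
  ∑ zero    f = 0#
  ∑ (suc n) f = f zero + ∑ n (λ i → f (suc i))

  Vector : ℕ → Set c
  Vector n = Fin n → Carrier

  Matrix : ℕ → ℕ → Set c
  Matrix m n = Fin m → Fin n → Carrier

  Tensor : ℕ → ℕ → ℕ → Set c
  Tensor l m n = Fin l → Fin m → Fin n → Carrier

  bil : ∀ {p q} → Vector p → Matrix p q → Vector q → Carrier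
  bil {p} {q} x M y = ∑ p (λ j → ∑ q (λ k → x j * (M j k * y k)))

  NonZero : ∀ {n} → Vector n → Set ℓ
  NonZero {n} x = ¬ (∀ i → x i ≈ 0#)

  module _ {l m n : ℕ} (𝒜 : Tensor l m n) where
    sliceA : Fin l → Matrix m n
    sliceA i j k = 𝒜 i j k

    sliceB : Fin m → Matrix l n
    sliceB j i k = 𝒜 i j k

    sliceC : Fin n → Matrix l m
    sliceC k i j = 𝒜 i j k

    IsSolution : Vector l → Vector m → Vector n → Set ℓ
    IsSolution u v w =
      NonZero u × NonZero v × NonZero w ×
      (∀ i → bil v (sliceA i) w ≈ 0#) ×
      (∀ j → bil u (sliceB j) w ≈ 0#) ×
      (∀ k → bil u (sliceC k) v ≈ 0#)

    HasSolution : Set (c ⊔ ℓ)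
    HasSolution = Σ (Vector l) λ u → Σ (Vector m) λ v → Σ (Vector n) λ w →
                  IsSolution u v w

-- The complexification K[i] = K × K of a ring K (pairs (a , b) = a + b i),
-- with componentwise equality and (a + b i)(c + d i) = (ac − bd) + (ad + bc) i.
complexify : RawRing c ℓ → RawRing c ℓ
complexify K = record
  { Carrier = Carrier × Carrier
  ; _≈_ = λ { (a , b) (a' , b') → (a ≈ a') × (b ≈ b') }
  ; _+_ = λ { (a , b) (a' , b') → (a + a' , b + b') }
  ; _*_ = λ { (a , b) (a' , b') → ((a * a') + (- (b * b')) , (a * b') + (b * a')) }
  ; -_  = λ { (a , b) → (- a , - b) }
  ; 0#  = (0# , 0#)
  ; 1#  = (1# , 0#)
  }
  where open RawRing K

embed : (K : RawRing c ℓ) {l m n : ℕ} → Tensor K l m n → Tensor (complexify K) l m n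
embed K 𝒜 i j k = (𝒜 i j k , RawRing.0# K)

{-# OPTIONS --safe #-}
-- Encode a + ib ∈ Kⁿ[i] as the real vector (a ; b) ∈ K²ⁿ, and take ℬ = ε ⊗ 𝒜, the Kronecker
-- product of 𝒜 with the 2 × 2 × 2 tensor ε x y z = Re (i^(x+y+z)).  Splitting a bilinear form
-- into 2 × 2 blocks shows that the slice of ℬ with block index s and slice index i, evaluated at
-- the encodings of v and w, equals Re (iˢ · vᵀ Aᵢ w).  For s = 0, 1 this is Re and −Im, so the
-- real equations say exactly that vᵀ Aᵢ w = 0.  Since ε is symmetric in its three indices, the
-- same holds for the other two slicings, and the encoding is a bijection that preserves
-- non-vanishing of vectors.
module Submission where

open import Defs
open import Data.Nat using (ℕ; _*_)
open import Data.Product using (Σ)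
open import Function.Bundles using (_⇔_)
open import Algebra.Bundles using (CommutativeRing)

import Data.Nat as ℕ
import Data.Nat.Properties as ℕ
open import Algebra.Bundles.Raw using (RawRing)
open import Data.Fin using (Fin; zero; suc; toℕ; _↑ˡ_; _↑ʳ_; combine; remQuot; quotient; remainder)
open import Data.Fin.Properties using (remQuot-combine; combine-remQuot)
open import Data.Product using (_×_; _,_; proj₁; proj₂; uncurry)
open import Data.Product.Function.NonDependent.Propositional using (_×-⇔_)
open import Function.Base using (_∘_)
open import Function.Bundles using (mk⇔; module Equivalence)
open import Relation.Binary.PropositionalEquality as ≡ using (_≡_)

∀-combine : ∀ {a} {m n} {P : Fin (m * n) → Set a} →
            (∀ I → P I) ⇔ (∀ x j → P (combine {m} {n} x j))
∀-combine {m = m} {n} {P} =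
  mk⇔ (λ h x j → h (combine x j))
      (λ h I → ≡.subst P (combine-remQuot {m} n I) (h _ _))

module Realification {c ℓ} (R : CommutativeRing c ℓ) where
  open CommutativeRing R hiding (zero) renaming (_*_ to _·_)
  open import Algebra.Properties.Ring ring using (-1*x≈-x; -0#≈0#; -‿injective; -‿+-comm)
  open import Algebra.Properties.CommutativeSemigroup *-commutativeSemigroup using (x∙yz≈y∙xz)
  open import Algebra.Properties.Semiring.Sum semiring
    using (sum; sum-cong-≋; sum-cong-≗; ∑-distrib-+; ∑-comm; *-distribˡ-sum)
  open import Relation.Binary.Reasoning.Setoid setoid

  ℂ : RawRing c ℓ
  ℂ = complexify rawRing

  open RawRing ℂ using () renaming (_≈_ to _≈ᶜ_; _*_ to _·ᶜ_; 0# to 0ᶜ)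

  sum₂ : (f : Fin 2 → Carrier) → sum f ≈ f zero + f (suc zero)
  sum₂ f = +-congˡ (+-identityʳ _)

  sum₂₂ : (g : Fin 2 → Fin 2 → Carrier) →
          sum (λ x → sum (g x)) ≈ (g zero zero + g zero (suc zero)) + (g (suc zero) zero + g (suc zero) (suc zero))
  sum₂₂ g = trans (sum₂ (λ x → sum (g x))) (+-cong (sum₂ (g zero)) (sum₂ (g (suc zero))))

  sum-↑ : ∀ a b (f : Fin (a ℕ.+ b) → Carrier) →
          sum f ≈ sum (λ i → f (i ↑ˡ b)) + sum (λ i → f (a ↑ʳ i))
  sum-↑ ℕ.zero    b f = sym (+-identityˡ _)
  sum-↑ (ℕ.suc a) b f = trans (+-congˡ (sum-↑ a b (f ∘ suc))) (sym (+-assoc _ _ _))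

  sum-combine : ∀ a b (f : Fin (a * b) → Carrier) →
                sum f ≈ sum (λ x → sum (λ j → f (combine {a} {b} x j)))
  sum-combine ℕ.zero    b f = refl
  sum-combine (ℕ.suc a) b f =
    trans (sum-↑ b (a * b) f) (+-congˡ (sum-combine a b (λ I → f (b ↑ʳ I))))

  sum-neg : ∀ {n} (f : Fin n → Carrier) → sum (λ i → - f i) ≈ - sum f
  sum-neg {ℕ.zero}  f = sym -0#≈0#
  sum-neg {ℕ.suc n} f = trans (+-congˡ (sum-neg (f ∘ suc))) (-‿+-comm _ _)

  sum-sub : ∀ {n} (f g : Fin n → Carrier) → sum (λ i → f i + - g i) ≈ sum f + - sum g
  sum-sub f g = trans (∑-distrib-+ f (λ i → - g i)) (+-congˡ (sum-neg g))

  ∑≡sum : ∀ n (f : Fin n → Carrier) → ∑ rawRing n f ≡ sum f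
  ∑≡sum ℕ.zero    f = ≡.refl
  ∑≡sum (ℕ.suc n) f = ≡.cong (f zero +_) (∑≡sum n (f ∘ suc))

  re-∑ᶜ : ∀ n (f : Fin n → Carrier × Carrier) → proj₁ (∑ ℂ n f) ≡ sum (proj₁ ∘ f)
  re-∑ᶜ ℕ.zero    f = ≡.refl
  re-∑ᶜ (ℕ.suc n) f = ≡.cong (proj₁ (f zero) +_) (re-∑ᶜ n (f ∘ suc))

  im-∑ᶜ : ∀ n (f : Fin n → Carrier × Carrier) → proj₂ (∑ ℂ n f) ≡ sum (proj₂ ∘ f)
  im-∑ᶜ ℕ.zero    f = ≡.refl
  im-∑ᶜ (ℕ.suc n) f = ≡.cong (proj₂ (f zero) +_) (im-∑ᶜ n (f ∘ suc))

  module _ {p q : ℕ} where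

    bil≡sum : (x : Fin p → Carrier) (M : Matrix rawRing p q) (y : Fin q → Carrier) →
              bil rawRing x M y ≡ sum (λ j → sum (λ k → x j · (M j k · y k)))
    bil≡sum x M y = ≡.trans (∑≡sum p (λ j → ∑ rawRing q (term j))) (sum-cong-≗ (λ j → ∑≡sum q (term j)))
      where
      term : Fin p → Fin q → Carrier
      term j k = x j · (M j k · y k)

    bil-cong : ∀ {x x′ M M′ y y′} → (∀ j → x j ≈ x′ j) → (∀ j k → M j k ≈ M′ j k) →
               (∀ k → y k ≈ y′ k) → bil rawRing x M y ≈ bil rawRing x′ M′ y′
    bil-cong {x} {x′} {M} {M′} {y} {y′} x≈ M≈ y≈ = begin
      bil rawRing x M y    ≡⟨ bil≡sum x M y ⟩
      _                    ≈⟨ sum-cong-≋ (λ j → sum-cong-≋ (λ k → *-cong (x≈ j) (*-cong (M≈ j k) (y≈ k)))) ⟩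
      _                    ≡⟨ bil≡sum x′ M′ y′ ⟨
      bil rawRing x′ M′ y′ ∎

    bil-scale : ∀ a x (M : Matrix rawRing p q) y →
                bil rawRing x (λ j k → a · M j k) y ≈ a · bil rawRing x M y
    bil-scale a x M y = begin
      bil rawRing x (λ j k → a · M j k) y
        ≡⟨ bil≡sum x _ y ⟩
      sum (λ j → sum (λ k → x j · ((a · M j k) · y k)))
        ≈⟨ sum-cong-≋ (λ j → sum-cong-≋ (λ k → pull-out (x j) (M j k) (y k))) ⟩
      sum (λ j → sum (λ k → a · (x j · (M j k · y k))))
        ≈⟨ sum-cong-≋ (λ j → *-distribˡ-sum a (term j)) ⟨
      sum (λ j → a · sum (term j))
        ≈⟨ *-distribˡ-sum a (λ j → sum (term j)) ⟨
      a · sum (λ j → sum (λ k → x j · (M j k · y k)))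
        ≡⟨ ≡.cong (a ·_) (bil≡sum x M y) ⟨
      a · bil rawRing x M y ∎
      where
      term : Fin p → Fin q → Carrier
      term j k = x j · (M j k · y k)

      pull-out : ∀ u m v → u · ((a · m) · v) ≈ a · (u · (m · v))
      pull-out u m v = trans (*-congˡ (*-assoc a m v)) (x∙yz≈y∙xz u a (m · v))

  bil-combine : ∀ {a b p q} (x : Fin (a * p) → Carrier) (M : Matrix rawRing (a * p) (b * q))
                (y : Fin (b * q) → Carrier) →
                bil rawRing x M y ≈
                sum (λ s → sum (λ t → bil rawRing (λ j → x (combine {a} {p} s j))
                                                  (λ j k → M (combine s j) (combine {b} {q} t k))
                                                  (λ k → y (combine t k))))
  bil-combine {a} {b} {p} {q} x M y = begin
    bil rawRing x M y
      ≡⟨ bil≡sum x M y ⟩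
    sum (λ J → sum (λ K → term J K))
      ≈⟨ sum-cong-≋ (λ J → sum-combine b q (term J)) ⟩
    sum (λ J → sum (λ t → sum (λ k → term J (col t k))))
      ≈⟨ sum-combine a p (λ J → sum (λ t → sum (λ k → term J (col t k)))) ⟩
    sum (λ s → sum (λ j → sum (λ t → sum (λ k → term (row s j) (col t k)))))
      ≈⟨ sum-cong-≋ (λ s → ∑-comm (λ j t → sum (λ k → term (row s j) (col t k)))) ⟩
    sum (λ s → sum (λ t → sum (λ j → sum (λ k → term (row s j) (col t k)))))
      ≡⟨ sum-cong-≗ (λ s → sum-cong-≗ (λ t →
           bil≡sum (λ j → x (row s j)) (λ j k → M (row s j) (col t k)) (λ k → y (col t k)))) ⟨
    sum (λ s → sum (λ t → bil rawRing (λ j → x (row s j))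
                                      (λ j k → M (row s j) (col t k))
                                      (λ k → y (col t k)))) ∎
    where
    term : Fin (a * p) → Fin (b * q) → Carrier
    term J K = x J · (M J K · y K)

    row : Fin a → Fin p → Fin (a * p)
    row = combine

    col : Fin b → Fin q → Fin (b * q)
    col = combine

  embedMatrix : ∀ {p q} → Matrix rawRing p q → Matrix ℂ p q
  embedMatrix M j k = (M j k , 0#)

  module _ {p q : ℕ} (v : Fin p → Carrier × Carrier) (M : Matrix rawRing p q)
           (w : Fin q → Carrier × Carrier) where

    private
      bilᶜ = bil ℂ v (embedMatrix M) w

      re-scale : ∀ m x y → m · x + - (0# · y) ≈ m · x
      re-scale m x y = trans (+-congˡ (trans (-‿cong (zeroˡ y)) -0#≈0#)) (+-identityʳ _)

      im-scale : ∀ m x y → m · y + 0# · x ≈ m · y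
      im-scale m x y = trans (+-congˡ (zeroˡ x)) (+-identityʳ _)

      term : Fin p → Fin q → Carrier × Carrier
      term j k = v j ·ᶜ (embedMatrix M j k ·ᶜ w k)

      part : (Carrier × Carrier → Carrier) → (Carrier × Carrier → Carrier) → Fin p → Fin q → Carrier
      part f g j k = f (v j) · (M j k · g (w k))

    re-bilᶜ : proj₁ bilᶜ ≈
              bil rawRing (proj₁ ∘ v) M (proj₁ ∘ w) + - bil rawRing (proj₂ ∘ v) M (proj₂ ∘ w)
    re-bilᶜ = begin
      proj₁ bilᶜ
        ≡⟨ ≡.trans (re-∑ᶜ p (λ j → ∑ ℂ q (term j))) (sum-cong-≗ (λ j → re-∑ᶜ q (term j))) ⟩
      sum (λ j → sum (λ k → proj₁ (term j k)))
        ≈⟨ sum-cong-≋ (λ j → sum-cong-≋ (λ k →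
             +-cong (*-congˡ (re-scale (M j k) _ _)) (-‿cong (*-congˡ (im-scale (M j k) _ _))))) ⟩
      sum (λ j → sum (λ k → part proj₁ proj₁ j k + - part proj₂ proj₂ j k))
        ≈⟨ sum-cong-≋ (λ j → sum-sub (part proj₁ proj₁ j) (part proj₂ proj₂ j)) ⟩
      sum (λ j → sum (part proj₁ proj₁ j) + - sum (part proj₂ proj₂ j))
        ≈⟨ sum-sub (λ j → sum (part proj₁ proj₁ j)) (λ j → sum (part proj₂ proj₂ j)) ⟩
      _ ≡⟨ ≡.cong₂ (λ a b → a + - b) (bil≡sum _ M _) (bil≡sum _ M _) ⟨
      _ ∎

    im-bilᶜ : proj₂ bilᶜ ≈
              bil rawRing (proj₁ ∘ v) M (proj₂ ∘ w) + bil rawRing (proj₂ ∘ v) M (proj₁ ∘ w)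
    im-bilᶜ = begin
      proj₂ bilᶜ
        ≡⟨ ≡.trans (im-∑ᶜ p (λ j → ∑ ℂ q (term j))) (sum-cong-≗ (λ j → im-∑ᶜ q (term j))) ⟩
      sum (λ j → sum (λ k → proj₂ (term j k)))
        ≈⟨ sum-cong-≋ (λ j → sum-cong-≋ (λ k →
             +-cong (*-congˡ (im-scale (M j k) _ _)) (*-congˡ (re-scale (M j k) _ _)))) ⟩
      sum (λ j → sum (λ k → part proj₁ proj₂ j k + part proj₂ proj₁ j k))
        ≈⟨ sum-cong-≋ (λ j → ∑-distrib-+ (part proj₁ proj₂ j) (part proj₂ proj₁ j)) ⟩
      sum (λ j → sum (part proj₁ proj₂ j) + sum (part proj₂ proj₁ j))
        ≈⟨ ∑-distrib-+ (λ j → sum (part proj₁ proj₂ j)) (λ j → sum (part proj₂ proj₁ j)) ⟩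
      _ ≡⟨ ≡.cong₂ _+_ (bil≡sum _ M _) (bil≡sum _ M _) ⟨
      _ ∎

  coord : Fin 2 → Carrier × Carrier → Carrier
  coord zero       = proj₁
  coord (suc zero) = proj₂

  Realifies : ∀ {n} → (Fin (2 * n) → Carrier) → (Fin n → Carrier × Carrier) → Set ℓ
  Realifies {n} V v = ∀ x j → V (combine {2} {n} x j) ≈ coord x (v j)

  toComplex : ∀ {n} → (Fin (2 * n) → Carrier) → Fin n → Carrier × Carrier
  toComplex {n} V j = V (combine {2} {n} zero j) , V (combine {2} {n} (suc zero) j)

  toReal : ∀ {n} → (Fin n → Carrier × Carrier) → Fin (2 * n) → Carrier
  toReal {n} v I = uncurry (λ x j → coord x (v j)) (remQuot n I)

  toComplex-realifies : ∀ {n} (V : Fin (2 * n) → Carrier) → Realifies V (toComplex {n} V)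
  toComplex-realifies V zero       j = refl
  toComplex-realifies V (suc zero) j = refl

  toReal-realifies : ∀ {n} (v : Fin n → Carrier × Carrier) → Realifies (toReal v) v
  toReal-realifies v x j = reflexive (≡.cong (uncurry (λ x j → coord x (v j))) (remQuot-combine x j))

  reIPow : ℕ → Carrier
  reIPow ℕ.zero              = 1#
  reIPow (ℕ.suc ℕ.zero)      = 0#
  reIPow (ℕ.suc (ℕ.suc n))   = - reIPow n

  ε : Tensor rawRing 2 2 2
  ε x y z = reIPow (toℕ x ℕ.+ toℕ y ℕ.+ toℕ z)

  ε-swap : ∀ x y z → ε x y z ≡ ε y x z
  ε-swap x y z = ≡.cong (λ t → reIPow (t ℕ.+ toℕ z)) (ℕ.+-comm (toℕ x) (toℕ y))

  ε-rotate : ∀ x y z → ε x y z ≡ ε z x y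
  ε-rotate x y z = ≡.cong reIPow (≡.trans (ℕ.+-comm (toℕ x ℕ.+ toℕ y) (toℕ z))
                                          (≡.sym (ℕ.+-assoc (toℕ z) (toℕ x) (toℕ y))))

  -- reTwist s z = Re (iˢ · z)
  reTwist : Fin 2 → Carrier × Carrier → Carrier
  reTwist zero       z = proj₁ z
  reTwist (suc zero) z = - proj₂ z

  -- The hypotheses say that z = ∑ iˣ⁺ʸ · b x y.
  ε-contract : ∀ s {z} (b : Fin 2 → Fin 2 → Carrier) →
               proj₁ z ≈ b zero zero + - b (suc zero) (suc zero) →
               proj₂ z ≈ b zero (suc zero) + b (suc zero) zero →
               sum (λ x → sum (λ y → ε s x y · b x y)) ≈ reTwist s z
  ε-contract s {z} b re im = trans (sum₂₂ (λ x y → ε s x y · b x y)) (contract s)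
    where
    b₀₀ b₀₁ b₁₀ b₁₁ : Carrier
    b₀₀ = b zero zero
    b₀₁ = b zero (suc zero)
    b₁₀ = b (suc zero) zero
    b₁₁ = b (suc zero) (suc zero)

    contract : ∀ s → (ε s zero zero · b₀₀ + ε s zero (suc zero) · b₀₁)
                   + (ε s (suc zero) zero · b₁₀ + ε s (suc zero) (suc zero) · b₁₁)
                   ≈ reTwist s z
    contract zero = begin
      (1# · b₀₀ + 0# · b₀₁) + (0# · b₁₀ + - 1# · b₁₁)
        ≈⟨ +-cong (+-cong (*-identityˡ _) (zeroˡ _)) (+-cong (zeroˡ _) (-1*x≈-x _)) ⟩
      (b₀₀ + 0#) + (0# + - b₁₁)
        ≈⟨ +-cong (+-identityʳ _) (+-identityˡ _) ⟩
      b₀₀ + - b₁₁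
        ≈⟨ re ⟨
      proj₁ z ∎
    contract (suc zero) = begin
      (0# · b₀₀ + - 1# · b₀₁) + (- 1# · b₁₀ + - 0# · b₁₁)
        ≈⟨ +-cong (+-cong (zeroˡ _) (-1*x≈-x _)) (+-cong (-1*x≈-x _) (trans (*-congʳ -0#≈0#) (zeroˡ _))) ⟩
      (0# + - b₀₁) + (- b₁₀ + 0#)
        ≈⟨ +-cong (+-identityˡ _) (+-identityʳ _) ⟩
      - b₀₁ + - b₁₀
        ≈⟨ -‿+-comm _ _ ⟩
      - (b₀₁ + b₁₀)
        ≈⟨ -‿cong im ⟨
      - proj₂ z ∎

  bil-realify : ∀ {p q} s (M : Matrix rawRing p q) {N : Matrix rawRing (2 * p) (2 * q)} {V W v w} →
                Realifies V v → Realifies W w →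
                (∀ x j y k → N (combine x j) (combine y k) ≈ ε s x y · M j k) →
                bil rawRing V N W ≈ reTwist s (bil ℂ v (embedMatrix M) w)
  bil-realify {p} {q} s M {N} {V} {W} {v} {w} V≈ W≈ N≈ = begin
    bil rawRing V N W
      ≈⟨ bil-combine {2} {2} {p} {q} V N W ⟩
    sum (λ x → sum (λ y → bil rawRing (λ j → V (row x j)) (λ j k → N (row x j) (col y k))
                                      (λ k → W (col y k))))
      ≈⟨ sum-cong-≋ (λ x → sum-cong-≋ (λ y →
           trans (bil-cong (V≈ x) (λ j k → N≈ x j y k) (W≈ y)) (bil-scale (ε s x y) (coord x ∘ v) M (coord y ∘ w)))) ⟩
    sum (λ x → sum (λ y → ε s x y · b x y))
      ≈⟨ ε-contract s b (re-bilᶜ v M w) (im-bilᶜ v M w) ⟩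
    reTwist s (bil ℂ v (embedMatrix M) w) ∎
    where
    row : Fin 2 → Fin p → Fin (2 * p)
    row = combine

    col : Fin 2 → Fin q → Fin (2 * q)
    col = combine

    b : Fin 2 → Fin 2 → Carrier
    b x y = bil rawRing (coord x ∘ v) M (coord y ∘ w)

  -x≈0⇒x≈0 : ∀ {x} → - x ≈ 0# → x ≈ 0#
  -x≈0⇒x≈0 -x≈0 = -‿injective (trans -x≈0 (sym -0#≈0#))

  coord≈0⇔≈0 : ∀ {z} → (∀ x → coord x z ≈ 0#) ⇔ z ≈ᶜ 0ᶜ
  coord≈0⇔≈0 = mk⇔ (λ h → h zero , h (suc zero))
                   (λ { (re , im) zero → re ; (re , im) (suc zero) → im })

  reTwist≈0⇔≈0 : ∀ {z} → (∀ s → reTwist s z ≈ 0#) ⇔ z ≈ᶜ 0ᶜ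
  reTwist≈0⇔≈0 = mk⇔ (λ h → h zero , -x≈0⇒x≈0 (h (suc zero)))
                     (λ { (re , im) zero → re ; (re , im) (suc zero) → trans (-‿cong im) -0#≈0# })

  allZero-transfer : ∀ {n} {X : Fin (2 * n) → Carrier} {z : Fin n → Carrier × Carrier}
                     (f : Fin 2 → Carrier × Carrier → Carrier) →
                     (∀ {ζ} → (∀ x → f x ζ ≈ 0#) ⇔ ζ ≈ᶜ 0ᶜ) →
                     (∀ x j → X (combine {2} {n} x j) ≈ f x (z j)) →
                     (∀ I → X I ≈ 0#) ⇔ (∀ j → z j ≈ᶜ 0ᶜ)
  allZero-transfer {n} {X} f f≈0⇔≈0 X≈ = mk⇔
    (λ X≈0 j → to f≈0⇔≈0 (λ x → trans (sym (X≈ x j)) (X≈0 (combine x j))))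
    (λ z≈0 → from (∀-combine {P = λ I → X I ≈ 0#}) (λ x j → trans (X≈ x j) (from f≈0⇔≈0 (z≈0 j) x)))
    where open Equivalence

  nonZero-transfer : ∀ {n} {V : Fin (2 * n) → Carrier} {v} → Realifies V v →
                     NonZero rawRing V ⇔ NonZero ℂ v
  nonZero-transfer {n} {V} {v} V≈ = mk⇔ (λ V≢0 v≈0 → V≢0 (from allZero v≈0)) (λ v≢0 V≈0 → v≢0 (to allZero V≈0))
    where
    open Equivalence
    allZero : (∀ I → V I ≈ 0#) ⇔ (∀ j → v j ≈ᶜ 0ᶜ)
    allZero = allZero-transfer {n} {V} coord coord≈0⇔≈0 V≈

  slices-transfer : ∀ {r p q} (M : Fin r → Matrix rawRing p q)
                    {N : Fin (2 * r) → Matrix rawRing (2 * p) (2 * q)} {V W v w} →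
                    Realifies V v → Realifies W w →
                    (∀ s i x j y k → N (combine s i) (combine x j) (combine y k) ≈ ε s x y · M i j k) →
                    (∀ I → bil rawRing V (N I) W ≈ 0#) ⇔ (∀ i → bil ℂ v (embedMatrix (M i)) w ≈ᶜ 0ᶜ)
  slices-transfer M V≈ W≈ N≈ =
    allZero-transfer reTwist reTwist≈0⇔≈0 (λ s i → bil-realify s (M i) V≈ W≈ (N≈ s i))

  _⊗_ : ∀ {a b c′ l m n} → Tensor rawRing a b c′ → Tensor rawRing l m n →
        Tensor rawRing (a * l) (b * m) (c′ * n)
  _⊗_ {a} {b} {c′} {l} {m} {n} T 𝒜 I J K =
    T (quotient {a} l I) (quotient {b} m J) (quotient {c′} n K)
    · 𝒜 (remainder {a} l I) (remainder {b} m J) (remainder {c′} n K)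

  ⊗-combine : ∀ {a b c′ l m n} (T : Tensor rawRing a b c′) (𝒜 : Tensor rawRing l m n) x y z i j k →
              (T ⊗ 𝒜) (combine {a} {l} x i) (combine {b} {m} y j) (combine {c′} {n} z k) ≡ T x y z · 𝒜 i j k
  ⊗-combine T 𝒜 x y z i j k =
    ≡.cong₂ _·_ (cong₃ T (≡.cong proj₁ (remQuot-combine x i)) (≡.cong proj₁ (remQuot-combine y j))
                         (≡.cong proj₁ (remQuot-combine z k)))
                (cong₃ 𝒜 (≡.cong proj₂ (remQuot-combine x i)) (≡.cong proj₂ (remQuot-combine y j))
                         (≡.cong proj₂ (remQuot-combine z k)))
    where
    cong₃ : ∀ {A B C : Set} (f : A → B → C → Carrier) {a a′ b b′ c c′} →
            a ≡ a′ → b ≡ b′ → c ≡ c′ → f a b c ≡ f a′ b′ c′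
    cong₃ f ≡.refl ≡.refl ≡.refl = ≡.refl

  solution-transfer : ∀ {l m n} (𝒜 : Tensor rawRing l m n) {U V W u v w} →
                      Realifies U u → Realifies V v → Realifies W w →
                      IsSolution rawRing (ε ⊗ 𝒜) U V W ⇔ IsSolution ℂ (embed rawRing 𝒜) u v w
  solution-transfer 𝒜 U≈ V≈ W≈ =
    nonZero-transfer U≈ ×-⇔ nonZero-transfer V≈ ×-⇔ nonZero-transfer W≈ ×-⇔
    slices-transfer (sliceA rawRing 𝒜) V≈ W≈
      (λ s i x j y k → reflexive (⊗-combine ε 𝒜 s x y i j k)) ×-⇔
    slices-transfer (sliceB rawRing 𝒜) U≈ W≈
      (λ s j x i y k → reflexive (≡.trans (⊗-combine ε 𝒜 x s y i j k)
                                          (≡.cong (_· 𝒜 i j k) (ε-swap x s y)))) ×-⇔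
    slices-transfer (sliceC rawRing 𝒜) U≈ V≈
      (λ s k x i y j → reflexive (≡.trans (⊗-combine ε 𝒜 x y s i j k)
                                          (≡.cong (_· 𝒜 i j k) (ε-rotate x y s))))

  hasSolution-transfer : ∀ {l m n} (𝒜 : Tensor rawRing l m n) →
                         HasSolution rawRing (ε ⊗ 𝒜) ⇔ HasSolution ℂ (embed rawRing 𝒜)
  hasSolution-transfer {l} {m} {n} 𝒜 = mk⇔ complexSolution realSolution
    where
    open Equivalence

    complexSolution : HasSolution rawRing (ε ⊗ 𝒜) → HasSolution ℂ (embed rawRing 𝒜)
    complexSolution (U , V , W , sol) =
      toComplex U , toComplex V , toComplex W ,
      to (solution-transfer 𝒜 (toComplex-realifies {l} U) (toComplex-realifies {m} V)
                              (toComplex-realifies {n} W)) sol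

    realSolution : HasSolution ℂ (embed rawRing 𝒜) → HasSolution rawRing (ε ⊗ 𝒜)
    realSolution (u , v , w , sol) =
      toReal u , toReal v , toReal w ,
      from (solution-transfer 𝒜 (toReal-realifies u) (toReal-realifies v) (toReal-realifies w)) sol

lemma5p5 : ∀ {c ℓ} (ℝ : CommutativeRing c ℓ) (l m n : ℕ)
             (𝒜 : Tensor (CommutativeRing.rawRing ℝ) l m n) →
             Σ (Tensor (CommutativeRing.rawRing ℝ) (2 * l) (2 * m) (2 * n)) λ ℬ →
               (HasSolution (CommutativeRing.rawRing ℝ) ℬ
                 ⇔ HasSolution (complexify (CommutativeRing.rawRing ℝ)) (embed (CommutativeRing.rawRing ℝ) 𝒜))
lemma5p5 ℝ l m n 𝒜 = ε ⊗ 𝒜 , hasSolution-transfer 𝒜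
  where open Realification ℝ
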